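{- For every PLTL formula $A$: $A$ is satisfiable if and only if $\tau_0[A]$ is satisfiable.
   Context: PLTL formulae are built from proposition symbols, $\mathbf{true}$, $\mathbf{false}$, $\neg,\vee,\wedge,\Rightarrow$ and temporal operators $\bigcirc$ (next), $\Diamond$ (sometime), $\Box$ (always), $\mathcal{U}$ (until), $\mathcal{W}$ (unless). A model is an infinite sequence $\sigma=s_0,s_1,\dots$ of sets of proposition symbols; $(\sigma,i)\models p$ iff $p\in s_i$; Boolean connectives as usual; $\bigcirc A$ holds at $i$ iff $A$ at $i+1$; $\Diamond A$ at $i$ iff $A$ at some $k\ge i$; $\Box A$ at $i$ iff $A$ at all $j\ge i$; $A\,\mathcal{U}\,B$ at $i$ iff $B$ at some $k\ge i$ and $A$ at all $j$, $i\le j<k$; $A\,\mathcal{W}\,B$ iff $A\,\mathcal{U}\,B$ or $\Box A$. The nullary connective $\mathbf{start}$ holds exactly at index $0$. $A$ is satisfiable if $(\sigma,0)\models A$ for some $\sigma$. A literal is a proposition symbol or its negation. A PLTL-clause is a formula $\mathbf{start}\Rightarrow\bigvee_c l_c$, $\bigwedge_a k_a\Rightarrow\bigcirc\bigvee_d l_d$ or $\bigwedge_b k_b\Rightarrow\Diamond l$ with all $k,l$ literals. The translation: $\tau_0[A]=\Box(\mathbf{start}\Rightarrow y)\wedge\tau_1[\Box(y\Rightarrow A)]$ with $y$ a fresh proposition symbol, where $\tau_1$, applied to formulae $\Box(x\Rightarrow W)$ ($x$ a proposition symbol), is computed by applying the following rewrite rules repeatedly until the result is a conjunction of formulae $\Box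 A_i$ with each $A_i$ a PLTL-clause (write $\tau_1[x\Rightarrow A]$ for $\tau_1[\Box(x\Rightarrow A)]$; $y,z,v$ denote proposition symbols new at each application; $l,m,l_i$ literals; $\neg\mathbf{true}$, $\neg\mathbf{false}$ are rewritten to $\mathbf{false}$, $\mathbf{true}$). (1) $x\Rightarrow(A\wedge B)\mapsto\tau_1[x\Rightarrow A]\wedge\tau_1[x\Rightarrow B]$; $x\Rightarrow(A\Rightarrow B)\mapsto\tau_1[x\Rightarrow\neg A\vee B]$; $x\Rightarrow\neg(A\wedge B)\mapsto\tau_1[x\Rightarrow\neg A\vee\neg B]$; $x\Rightarrow\neg(A\Rightarrow B)\mapsto\tau_1[x\Rightarrow A]\wedge\tau_1[x\Rightarrow\neg B]$; $x\Rightarrow\neg(A\vee B)\mapsto\tau_1[x\Rightarrow\neg A]\wedge\tau_1[x\Rightarrow\neg B]$. (2) $x\Rightarrow\bigcirc A\mapsto\Box(x\Rightarrow\bigcirc y)\wedge\tau_1[y\Rightarrow A]$ if $A$ is neither a literal nor a disjunction of literals; $x\Rightarrow\neg\bigcirc A\mapsto\Box(x\Rightarrow\bigcirc y)\wedge\tau_1[y\Rightarrow\neg A]$; $x\Rightarrow\Box A\mapsto\tau_1[x\Rightarrow\Box y]\wedge\tau_1[y\Rightarrow A]$ if $A$ is not a literal; $x\Rightarrow\neg\Box A\mapsto\Box(x\Rightarrow\Diamond y)\wedge\tau_1[y\Rightarrow\neg A]$; $x\Rightarrow\Diamond A\mapsto\Box(x\Rightarrow\Diamond y)\wedge\tau_1[y\Rightarrow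 A]$ if $A$ is not a literal; $x\Rightarrow\neg\Diamond A\mapsto\tau_1[x\Rightarrow\Box y]\wedge\tau_1[y\Rightarrow\neg A]$; $x\Rightarrow A\,\mathcal{U}\,B\mapsto\tau_1[x\Rightarrow y\,\mathcal{U}\,B]\wedge\tau_1[y\Rightarrow A]$ if $A$ is not a literal, and $\mapsto\tau_1[x\Rightarrow A\,\mathcal{U}\,y]\wedge\tau_1[y\Rightarrow B]$ if $B$ is not a literal; the same two rules with $\mathcal{W}$ in place of $\mathcal{U}$; $x\Rightarrow\neg(A\,\mathcal{U}\,B)\mapsto\tau_1[x\Rightarrow y\,\mathcal{W}\,v]\wedge\tau_1[y\Rightarrow\neg B]\wedge\tau_1[v\Rightarrow(y\wedge z)]\wedge\tau_1[z\Rightarrow\neg A]$; $x\Rightarrow\neg(A\,\mathcal{W}\,B)\mapsto\tau_1[x\Rightarrow y\,\mathcal{U}\,v]\wedge\tau_1[y\Rightarrow\neg B]\wedge\tau_1[v\Rightarrow(y\wedge z)]\wedge\tau_1[z\Rightarrow\neg A]$. (3) $x\Rightarrow\Box l\mapsto\tau_1[x\Rightarrow l]\wedge\tau_1[x\Rightarrow y]\wedge\Box(y\Rightarrow\bigcirc l)\wedge\Box(y\Rightarrow\bigcirc y)$; $x\Rightarrow l\,\mathcal{U}\,m\mapsto\Box(x\Rightarrow\Diamond m)\wedge\tau_1[x\Rightarrow l\vee m]\wedge\tau_1[x\Rightarrow y\vee m]\wedge\Box(y\Rightarrow\bigcirc(l\vee m))\wedge\Box(y\Rightarrow\bigcirc(y\vee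 m))$; $x\Rightarrow l\,\mathcal{W}\,m\mapsto$ the same without the conjunct $\Box(x\Rightarrow\Diamond m)$. (4) $x\Rightarrow D\vee A\mapsto\tau_1[x\Rightarrow D\vee y]\wedge\tau_1[y\Rightarrow A]$, where $D$ is a disjunction and $A$ is neither a literal nor a disjunction of literals. (5) $x\Rightarrow D\mapsto\Box(\mathbf{start}\Rightarrow\neg x\vee D)\wedge\Box(\mathbf{true}\Rightarrow\bigcirc(\neg x\vee D))$ for $D$ a literal or disjunction of literals; $x\Rightarrow\mathbf{true}\mapsto\Box(\mathbf{start}\Rightarrow\mathbf{true})\wedge\Box(\mathbf{true}\Rightarrow\bigcirc\mathbf{true})$; $x\Rightarrow\mathbf{false}\mapsto\Box(\mathbf{start}\Rightarrow\neg x)\wedge\Box(\mathbf{true}\Rightarrow\bigcirc\neg x)$; $\tau_1[x\Rightarrow\Diamond l]=\Box(x\Rightarrow\Diamond l)$ and $\tau_1[x\Rightarrow\bigcirc(l_1\vee\dots\vee l_n)]=\Box(x\Rightarrow\bigcirc(l_1\vee\dots\vee l_n))$. $\tau_1[\cdot]$ and $\tau_0[\cdot]$ denote the final results. -}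

module Defs where

open import Data.Nat using (ℕ; zero; suc; _≤_; _<_; _⊔_)
open import Data.Bool using (Bool; T)
open import Data.List using (List; []; _∷_; _++_; map)
open import Data.Product using (Σ; ∃; _×_; _,_)
open import Data.Sum using (_⊎_)
open import Data.Unit using (⊤)
open import Data.Empty using (⊥)
open import Data.Maybe using (Maybe; just; nothing)
open import Relation.Binary.PropositionalEquality using (_≡_)
open import Relation.Nullary using (¬_)

Atom : Set
Atom = ℕ

data Fml : Set where
  atom     : Atom → Fml
  TRUE     : Fml
  FALSE    : Fml
  NOT      : Fml → Fml
  OR       : Fml → Fml → Fml
  AND      : Fml → Fml → Fml
  IMP      : Fml → Fml → Fml
  NEXT     : Fml → Fml
  SOMETIME : Fml → Fml
  ALWAYS   : Fml → Fml
  UNTIL    : Fml → Fml → Fml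
  UNLESS   : Fml → Fml → Fml

-- Formulae with the extra nullary connective `start`
-- (the language in which the output of the translation lives).

data LTL : Set where
  atom     : Atom → LTL
  TRUE     : LTL
  FALSE    : LTL
  START    : LTL
  NOT      : LTL → LTL
  OR       : LTL → LTL → LTL
  AND      : LTL → LTL → LTL
  IMP      : LTL → LTL → LTL
  NEXT     : LTL → LTL
  SOMETIME : LTL → LTL
  ALWAYS   : LTL → LTL
  UNTIL    : LTL → LTL → LTL
  UNLESS   : LTL → LTL → LTL

emb : Fml → LTL
emb (atom p)     = atom p
emb TRUE         = TRUE
emb FALSE        = FALSE
emb (NOT A)      = NOT (emb A)
emb (OR A B)     = OR (emb A) (emb B)
emb (AND A B)    = AND (emb A) (emb B)
emb (IMP A B)    = IMP (emb A) (emb B)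
emb (NEXT A)     = NEXT (emb A)
emb (SOMETIME A) = SOMETIME (emb A)
emb (ALWAYS A)   = ALWAYS (emb A)
emb (UNTIL A B)  = UNTIL (emb A) (emb B)
emb (UNLESS A B) = UNLESS (emb A) (emb B)

-- Semantics.  A model is an infinite sequence s_0, s_1, ... of sets of
-- proposition symbols, s_i given by its characteristic function.

Model : Set
Model = ℕ → Atom → Bool

infix 4 _,_⊨_
_,_⊨_ : Model → ℕ → LTL → Set
σ , i ⊨ atom p       = T (σ i p)
σ , i ⊨ TRUE         = ⊤
σ , i ⊨ FALSE        = ⊥
σ , i ⊨ START        = i ≡ 0
σ , i ⊨ NOT A        = ¬ (σ , i ⊨ A)
σ , i ⊨ OR A B       = (σ , i ⊨ A) ⊎ (σ , i ⊨ B)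
σ , i ⊨ AND A B      = (σ , i ⊨ A) × (σ , i ⊨ B)
σ , i ⊨ IMP A B      = (σ , i ⊨ A) → (σ , i ⊨ B)
σ , i ⊨ NEXT A       = σ , suc i ⊨ A
σ , i ⊨ SOMETIME A   = Σ ℕ λ k → i ≤ k × (σ , k ⊨ A)
σ , i ⊨ ALWAYS A     = (j : ℕ) → i ≤ j → σ , j ⊨ A
σ , i ⊨ UNTIL A B    =
  Σ ℕ λ k → i ≤ k × (σ , k ⊨ B) × ((j : ℕ) → i ≤ j → j < k → σ , j ⊨ A)
σ , i ⊨ UNLESS A B   =
  (Σ ℕ λ k → i ≤ k × (σ , k ⊨ B) × ((j : ℕ) → i ≤ j → j < k → σ , j ⊨ A))
  ⊎ ((j : ℕ) → i ≤ j → σ , j ⊨ A)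

Satisfiable : LTL → Set
Satisfiable A = Σ Model λ σ → σ , 0 ⊨ A

data Lit : Set where
  posL : Atom → Lit
  negL : Atom → Lit

litF : Lit → LTL
litF (posL p) = atom p
litF (negL p) = NOT (atom p)

disjF : Lit → List Lit → LTL
disjF l []       = litF l
disjF l (m ∷ ms) = OR (litF l) (disjF m ms)

-- rule (5):  x ⇒ D  ↦  □(start ⇒ ¬x ∨ D) ∧ □(true ⇒ ○(¬x ∨ D))
-- (with D = [] this is the case x ⇒ false)
rule5 : Atom → List Lit → List LTL
rule5 x ls = IMP START (disjF (negL x) ls) ∷ IMP TRUE (NEXT (disjF (negL x) ls)) ∷ []

rule5true : List LTL
rule5true = IMP START TRUE ∷ IMP TRUE (NEXT TRUE) ∷ []

stepC : Atom → Lit → List Lit → LTL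
stepC x l ls = IMP (atom x) (NEXT (disjF l ls))

evC : Atom → Lit → LTL
evC x l = IMP (atom x) (SOMETIME (litF l))

-- Fresh-name supply: a counter of the next unused proposition symbol.

M : Set → Set
M A = ℕ → A × ℕ

return : {A : Set} → A → M A
return a n = a , n

_>>=_ : {A B : Set} → M A → (A → M B) → M B
(m >>= f) n with m n
... | a , n' = f a n'

fresh : M Atom
fresh n = n , suc n

boxLit : Atom → Lit → M (List LTL)
boxLit x l = fresh >>= λ y →
  return (rule5 x (l ∷ []) ++ rule5 x (posL y ∷ []) ++ stepC y l [] ∷ stepC y (posL y) [] ∷ [])

unlessLit : Atom → Lit → Lit → M (List LTL)
unlessLit x l m = fresh >>= λ y →
  return (rule5 x (l ∷ m ∷ []) ++ rule5 x (posL y ∷ m ∷ [])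
          ++ stepC y l (m ∷ []) ∷ stepC y (posL y) (m ∷ []) ∷ [])

untilLit : Atom → Lit → Lit → M (List LTL)
untilLit x l m = unlessLit x l m >>= λ cs → return (evC x m ∷ cs)

litOf : Fml → Maybe Lit
litOf (atom p)       = just (posL p)
litOf (NOT (atom p)) = just (negL p)
litOf _              = nothing

dlits : Fml → Maybe (Lit × List Lit)
dlits (OR A B) with dlits A | dlits B
... | just (l , ls) | just (m , ms) = just (l , ls ++ m ∷ ms)
... | _ | _ = nothing
dlits A with litOf A
... | just l  = just (l , [])
... | nothing = nothing

-- τ₁.  pos x A computes τ₁[x ⇒ A], neg x A computes τ₁[x ⇒ ¬A];
-- each returns the list of PLTL-clauses A_i (the result is ⋀ □ A_i).

mutual
  pos : Atom → Fml → M (List LTL)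
  pos x (atom p)     = return (rule5 x (posL p ∷ []))
  pos x TRUE         = return rule5true
  pos x FALSE        = return (rule5 x [])
  pos x (NOT A)      = neg x A
  pos x (AND A B)    = pos x A >>= λ c₁ → pos x B >>= λ c₂ → return (c₁ ++ c₂)
  pos x (OR A B)     = dP A >>= λ { (l₁ , c₁) → dP B >>= λ { (l₂ , c₂) →
                         return (rule5 x (l₁ ++ l₂) ++ c₁ ++ c₂) } }
  pos x (IMP A B)    = dN A >>= λ { (l₁ , c₁) → dP B >>= λ { (l₂ , c₂) →
                         return (rule5 x (l₁ ++ l₂) ++ c₁ ++ c₂) } }
  pos x (NEXT A) with dlits A
  ... | just (l , ls) = return (stepC x l ls ∷ [])
  ... | nothing       = fresh >>= λ y → pos y A >>= λ cs →
                          return (stepC x (posL y) [] ∷ cs)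
  pos x (SOMETIME A) with litOf A
  ... | just l  = return (evC x l ∷ [])
  ... | nothing = fresh >>= λ y → pos y A >>= λ cs → return (evC x (posL y) ∷ cs)
  pos x (ALWAYS A) with litOf A
  ... | just l  = boxLit x l
  ... | nothing = fresh >>= λ y → boxLit x (posL y) >>= λ c₁ → pos y A >>= λ c₂ →
                    return (c₁ ++ c₂)
  pos x (UNTIL A B)  = litArg A >>= λ { (l , c₁) → litArg B >>= λ { (m , c₂) →
                         untilLit x l m >>= λ c₃ → return (c₃ ++ c₁ ++ c₂) } }
  pos x (UNLESS A B) = litArg A >>= λ { (l , c₁) → litArg B >>= λ { (m , c₂) →
                         unlessLit x l m >>= λ c₃ → return (c₃ ++ c₁ ++ c₂) } }

  neg : Atom → Fml → M (List LTL)
  neg x (atom p)     = return (rule5 x (negL p ∷ []))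
  neg x TRUE         = return (rule5 x [])
  neg x FALSE        = return rule5true
  neg x (NOT A)      = pos x A
  neg x (AND A B)    = dN A >>= λ { (l₁ , c₁) → dN B >>= λ { (l₂ , c₂) →
                         return (rule5 x (l₁ ++ l₂) ++ c₁ ++ c₂) } }
  neg x (OR A B)     = neg x A >>= λ c₁ → neg x B >>= λ c₂ → return (c₁ ++ c₂)
  neg x (IMP A B)    = pos x A >>= λ c₁ → neg x B >>= λ c₂ → return (c₁ ++ c₂)
  neg x (NEXT A)     = fresh >>= λ y → neg y A >>= λ cs →
                         return (stepC x (posL y) [] ∷ cs)
  neg x (ALWAYS A)   = fresh >>= λ y → neg y A >>= λ cs →
                         return (evC x (posL y) ∷ cs)
  neg x (SOMETIME A) = fresh >>= λ y → boxLit x (posL y) >>= λ c₁ → neg y A >>= λ c₂ →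
                         return (c₁ ++ c₂)
  neg x (UNTIL A B)  = fresh >>= λ y → fresh >>= λ z → fresh >>= λ v →
                         unlessLit x (posL y) (posL v) >>= λ c₁ →
                         neg y B >>= λ c₂ → neg z A >>= λ c₃ →
                         return (c₁ ++ c₂ ++ rule5 v (posL y ∷ []) ++ rule5 v (posL z ∷ []) ++ c₃)
  neg x (UNLESS A B) = fresh >>= λ y → fresh >>= λ z → fresh >>= λ v →
                         untilLit x (posL y) (posL v) >>= λ c₁ →
                         neg y B >>= λ c₂ → neg z A >>= λ c₃ →
                         return (c₁ ++ c₂ ++ rule5 v (posL y ∷ []) ++ rule5 v (posL z ∷ []) ++ c₃)

  litArg : Fml → M (Lit × List LTL)
  litArg A with litOf A
  ... | just l  = return (l , [])
  ... | nothing = fresh >>= λ y → pos y A >>= λ cs → return (posL y , cs)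

  dP : Fml → M (List Lit × List LTL)
  dP (OR A B) = dP A >>= λ { (l₁ , c₁) → dP B >>= λ { (l₂ , c₂) →
                  return (l₁ ++ l₂ , c₁ ++ c₂) } }
  dP A with litOf A
  ... | just l  = return (l ∷ [] , [])
  ... | nothing = fresh >>= λ y → pos y A >>= λ cs → return (posL y ∷ [] , cs)

  dN : Fml → M (List Lit × List LTL)
  dN (atom p) = return (negL p ∷ [] , [])
  dN A        = fresh >>= λ y → neg y A >>= λ cs → return (posL y ∷ [] , cs)

maxAtom : Fml → ℕ
maxAtom (atom p)     = p
maxAtom TRUE         = 0
maxAtom FALSE        = 0
maxAtom (NOT A)      = maxAtom A
maxAtom (OR A B)     = maxAtom A ⊔ maxAtom B
maxAtom (AND A B)    = maxAtom A ⊔ maxAtom B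
maxAtom (IMP A B)    = maxAtom A ⊔ maxAtom B
maxAtom (NEXT A)     = maxAtom A
maxAtom (SOMETIME A) = maxAtom A
maxAtom (ALWAYS A)   = maxAtom A
maxAtom (UNTIL A B)  = maxAtom A ⊔ maxAtom B
maxAtom (UNLESS A B) = maxAtom A ⊔ maxAtom B

bigAnd : LTL → List LTL → LTL
bigAnd B []       = B
bigAnd B (C ∷ Cs) = AND B (bigAnd C Cs)

-- the clauses of τ₁[□(y ⇒ A)], fresh symbols taken from suc (suc (maxAtom A)) on
τ₁ : Atom → Fml → List LTL
τ₁ y A with pos y A (suc y)
... | cs , _ = cs

τ₀ : Fml → LTL
τ₀ A = bigAnd (ALWAYS (IMP START (atom y))) (map ALWAYS (τ₁ y A))
  where y = suc (maxAtom A)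

{-# OPTIONS --safe #-}
module Submission where

-- A model of τ₀[A] is a model of A: its first clause makes y true at 0, and by induction on the
-- translation every symbol x that τ₁ introduces for a formula B satisfies □(x ⇒ B).  For the
-- clause groups of rule (3) this is an invariant argument on their auxiliary symbol, with excluded
-- middle locating the first point at which the right argument of a W-formula holds.
--
-- Conversely, a model of A is extended one fresh symbol at a time, each fresh symbol being read
-- (classically) as the truth value of the formula it names.  A step changes only symbols at or
-- above the current counter, which the clauses produced so far do not mention, so they stay true.

open import Defs
open import Level using (0ℓ)
open import Axiom.ExcludedMiddle using (ExcludedMiddle)
open import Axiom.DoubleNegationElimination using (em⇒dne)
open import Function.Base using (case_of_)
open import Function.Bundles using (_⇔_; mk⇔; Equivalence)
open import Data.Nat using (ℕ; zero; suc; _≤_; _<_; _⊔_; _≤′_; ≤′-refl; ≤′-step; z≤n; s≤s; _+_; _∸_)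
open import Data.Nat.Properties
open import Data.Bool using (Bool; T; if_then_else_)
open import Data.Bool.Properties using (T?)
open import Data.List using (List; []; _∷_; _++_; map)
open import Data.List.Relation.Unary.All using (All; []; _∷_)
import Data.List.Relation.Unary.All.Properties as All
open import Data.List.Relation.Unary.Any using (Any; here; there)
import Data.List.Relation.Unary.Any.Properties as Any
open import Data.Product using (Σ; _×_; _,_; proj₁; proj₂)
open import Data.Sum using (_⊎_; inj₁; inj₂; [_,_]′)
import Data.Sum as Sum
open import Data.Unit using (tt)
open import Data.Empty using (⊥; ⊥-elim)
open import Data.Maybe using (just; nothing)
open import Relation.Binary.PropositionalEquality using (_≡_; refl; sym; trans; cong; subst)
open import Relation.Binary.Definitions using (tri<; tri≈; tri>)
open import Relation.Nullary using (¬_; yes; no; does)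
open import Relation.Nullary.Decidable using (dec-true; dec-false; isYes; toWitness; fromWitness)
open import Relation.Unary using (Pred; _⊆_; ∁; _∩_; _∪_)

Always : Pred ℕ 0ℓ → Pred ℕ 0ℓ
Always P i = ∀ j → i ≤ j → P j

Eventually : Pred ℕ 0ℓ → Pred ℕ 0ℓ
Eventually P i = Σ ℕ λ k → i ≤ k × P k

Until : Pred ℕ 0ℓ → Pred ℕ 0ℓ → Pred ℕ 0ℓ
Until P Q i = Σ ℕ λ k → i ≤ k × Q k × (∀ j → i ≤ j → j < k → P j)

Unless : Pred ℕ 0ℓ → Pred ℕ 0ℓ → Pred ℕ 0ℓ
Unless P Q = Until P Q ∪ Always P

BinaryOp : Set₁
BinaryOp = Pred ℕ 0ℓ → Pred ℕ 0ℓ → Pred ℕ 0ℓ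

Monotone : BinaryOp → Set₁
Monotone 𝕆 = ∀ {P P′ Q Q′ : Pred ℕ 0ℓ} → P ⊆ P′ → Q ⊆ Q′ → 𝕆 P Q ⊆ 𝕆 P′ Q′

until-mono : Monotone Until
until-mono P⊆P′ Q⊆Q′ (k , i≤k , q , p) = k , i≤k , Q⊆Q′ q , λ j i≤j j<k → P⊆P′ (p j i≤j j<k)

unless-mono : Monotone Unless
unless-mono P⊆P′ Q⊆Q′ (inj₁ u) = inj₁ (until-mono P⊆P′ Q⊆Q′ u)
unless-mono P⊆P′ Q⊆Q′ (inj₂ a) = inj₂ (λ j i≤j → P⊆P′ (a j i≤j))

module _ {P Q : Pred ℕ 0ℓ} where

  unless-now : ∀ {i} → Unless P Q i → P i ⊎ Q i
  unless-now (inj₁ (k , i≤k , q , p)) with m≤n⇒m<n∨m≡n i≤k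
  ... | inj₁ i<k  = inj₁ (p _ ≤-refl i<k)
  ... | inj₂ refl = inj₂ q
  unless-now (inj₂ a) = inj₁ (a _ ≤-refl)

  unless-step : ∀ {i} → Unless P Q i → ¬ Q i → Unless P Q (suc i)
  unless-step (inj₁ (k , i≤k , q , p)) ¬q with m≤n⇒m<n∨m≡n i≤k
  ... | inj₁ i<k  = inj₁ (k , i<k , q , λ j i<j → p j (<⇒≤ i<j))
  ... | inj₂ refl = ⊥-elim (¬q q)
  unless-step (inj₂ a) _ = inj₂ (λ j i<j → a j (<⇒≤ i<j))

  until-cons : ∀ {i} → P i → Until P Q (suc i) → Until P Q i
  until-cons {i} p (k , i<k , q , later) = k , <⇒≤ i<k , q , now-or-later
    where
    now-or-later : ∀ j → i ≤ j → j < k → P j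
    now-or-later j i≤j j<k with m≤n⇒m<n∨m≡n i≤j
    ... | inj₁ i<j  = later j i<j j<k
    ... | inj₂ refl = p

  until-of-unless : ∀ {i} → Unless P Q i → Eventually Q i → Until P Q i
  until-of-unless (inj₁ u) _             = u
  until-of-unless (inj₂ a) (k , i≤k , q) = k , i≤k , q , λ j i≤j _ → a j i≤j

  unless-excludes-until : ∀ {i} → Unless (∁ Q) (∁ P ∩ ∁ Q) i → ¬ Until P Q i
  unless-excludes-until (inj₂ ¬q) (k , i≤k , q , _) = ¬q k i≤k q
  unless-excludes-until (inj₁ (k′ , i≤k′ , (¬p , ¬q) , before)) (k , i≤k , q , p) with <-cmp k k′
  ... | tri< k<k′ _ _ = before k i≤k k<k′ q
  ... | tri≈ _ refl _ = ¬q q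
  ... | tri> _ _ k′<k = ¬p (p k′ i≤k′ k′<k)

  until-excludes-unless : ∀ {i} → Until (∁ Q) (∁ P ∩ ∁ Q) i → ¬ Unless P Q i
  until-excludes-unless u (inj₁ v) = unless-excludes-until (inj₁ u) v
  until-excludes-unless (k , i≤k , (¬p , _) , _) (inj₂ a) = ¬p (a k i≤k)

module _ {P Q Y : Pred ℕ 0ℓ} {i : ℕ} where

  invariant-while : ((P ∩ Y) ∪ Q) i → (∀ j → Y j → ((P ∩ Y) ∪ Q) (suc j)) →
                    ∀ {j} → i ≤′ j → (∀ k → i ≤ k → k ≤ j → ¬ Q k) → (P ∩ Y) j
  invariant-while start step ≤′-refl ¬q with start
  ... | inj₁ py = py
  ... | inj₂ q  = ⊥-elim (¬q _ ≤-refl ≤-refl q)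
  invariant-while start step (≤′-step {j} i≤′j) ¬q
    with step j (proj₂ (invariant-while start step i≤′j (λ k i≤k k≤j → ¬q k i≤k (m≤n⇒m≤1+n k≤j))))
  ... | inj₁ py = py
  ... | inj₂ q  = ⊥-elim (¬q (suc j) (≤′⇒≤ (≤′-step i≤′j)) ≤-refl q)

always-by-invariant : ∀ {P Y : Pred ℕ 0ℓ} {i} → (P ∩ Y) i → (∀ j → Y j → (P ∩ Y) (suc j)) → Always P i
always-by-invariant {P} {Y} start step j i≤j =
  proj₁ (invariant-while {P} {λ _ → ⊥} {Y} (inj₁ start) (λ k y → inj₁ (step k y)) (≤⇒≤′ i≤j) (λ _ _ _ ()))

infix 4 _≈[_]_

record _≈[_]_ (σ : Model) (n : ℕ) (τ : Model) : Set where
  constructor agree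
  field
    agree-at : ∀ p → p < n → ∀ i → σ i p ≡ τ i p

open _≈[_]_

≈-refl : ∀ {σ n} → σ ≈[ n ] σ
≈-refl = agree (λ _ _ _ → refl)

≈-sym : ∀ {σ τ n} → σ ≈[ n ] τ → τ ≈[ n ] σ
≈-sym σ≈τ = agree (λ p p<n i → sym (agree-at σ≈τ p p<n i))

≈-trans : ∀ {σ τ ρ n} → σ ≈[ n ] τ → τ ≈[ n ] ρ → σ ≈[ n ] ρ
≈-trans σ≈τ τ≈ρ = agree (λ p p<n i → trans (agree-at σ≈τ p p<n i) (agree-at τ≈ρ p p<n i))

≈-weaken : ∀ {σ τ m n} → m ≤ n → σ ≈[ n ] τ → σ ≈[ m ] τ
≈-weaken m≤n σ≈τ = agree (λ p p<m → agree-at σ≈τ p (<-≤-trans p<m m≤n))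

≈-trans≤ : ∀ {σ τ ρ m n} → σ ≈[ m ] τ → m ≤ n → τ ≈[ n ] ρ → σ ≈[ m ] ρ
≈-trans≤ σ≈τ m≤n τ≈ρ = ≈-trans σ≈τ (≈-weaken m≤n τ≈ρ)

T-resp-≈ : ∀ {σ τ n p i} → σ ≈[ n ] τ → p < n → T (σ i p) → T (τ i p)
T-resp-≈ {i = i} σ≈τ p<n = subst T (agree-at σ≈τ _ p<n i)

atomOf : Lit → Atom
atomOf (posL p) = p
atomOf (negL p) = p

lit-resp-≈ : ∀ l {σ τ n i} → σ ≈[ n ] τ → atomOf l < n → σ , i ⊨ litF l → τ , i ⊨ litF l
lit-resp-≈ (posL p) σ≈τ p<n = T-resp-≈ σ≈τ p<n
lit-resp-≈ (negL p) σ≈τ p<n ¬p pτ = ¬p (T-resp-≈ (≈-sym σ≈τ) p<n pτ)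

⊨-resp-≈ : ∀ A {σ τ n i} → σ ≈[ n ] τ → maxAtom A < n → σ , i ⊨ emb A → τ , i ⊨ emb A
⊨-resp-≈ (atom p)     σ≈τ A<n = T-resp-≈ σ≈τ A<n
⊨-resp-≈ TRUE         σ≈τ A<n a = a
⊨-resp-≈ FALSE        σ≈τ A<n ()
⊨-resp-≈ (NOT A)      σ≈τ A<n ¬a a = ¬a (⊨-resp-≈ A (≈-sym σ≈τ) A<n a)
⊨-resp-≈ (OR A B)     σ≈τ A<n (inj₁ a) = inj₁ (⊨-resp-≈ A σ≈τ (m⊔n<o⇒m<o _ _ A<n) a)
⊨-resp-≈ (OR A B)     σ≈τ A<n (inj₂ b) = inj₂ (⊨-resp-≈ B σ≈τ (m⊔n<o⇒n<o _ _ A<n) b)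
⊨-resp-≈ (AND A B)    σ≈τ A<n (a , b) =
  ⊨-resp-≈ A σ≈τ (m⊔n<o⇒m<o _ _ A<n) a , ⊨-resp-≈ B σ≈τ (m⊔n<o⇒n<o _ _ A<n) b
⊨-resp-≈ (IMP A B)    σ≈τ A<n a⇒b a =
  ⊨-resp-≈ B σ≈τ (m⊔n<o⇒n<o _ _ A<n) (a⇒b (⊨-resp-≈ A (≈-sym σ≈τ) (m⊔n<o⇒m<o _ _ A<n) a))
⊨-resp-≈ (NEXT A)     σ≈τ A<n = ⊨-resp-≈ A σ≈τ A<n
⊨-resp-≈ (SOMETIME A) σ≈τ A<n (k , i≤k , a) = k , i≤k , ⊨-resp-≈ A σ≈τ A<n a
⊨-resp-≈ (ALWAYS A)   σ≈τ A<n a j i≤j = ⊨-resp-≈ A σ≈τ A<n (a j i≤j)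
⊨-resp-≈ (UNTIL A B)  σ≈τ A<n =
  until-mono (⊨-resp-≈ A σ≈τ (m⊔n<o⇒m<o _ _ A<n)) (⊨-resp-≈ B σ≈τ (m⊔n<o⇒n<o _ _ A<n))
⊨-resp-≈ (UNLESS A B) σ≈τ A<n =
  unless-mono (⊨-resp-≈ A σ≈τ (m⊔n<o⇒m<o _ _ A<n)) (⊨-resp-≈ B σ≈τ (m⊔n<o⇒n<o _ _ A<n))

update : Model → Atom → (ℕ → Bool) → Model
update σ y b i p = if does (p ≟ y) then b i else σ i p

update-≡ : ∀ σ y b i → update σ y b i y ≡ b i
update-≡ σ y b i rewrite dec-true (y ≟ y) refl = refl

update-≈ : ∀ {σ y b} → σ ≈[ y ] update σ y b
update-≈ {σ} {y} {b} = agree λ p p<y i →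
  cong (λ c → if c then b i else σ i p) (sym (dec-false (p ≟ y) (<⇒≢ p<y)))

infix 4 _,_⊨∨_ _⊨*_ _⊨_⇛_

_,_⊨∨_ : Model → ℕ → List Lit → Set
σ , i ⊨∨ ls = Any (λ l → σ , i ⊨ litF l) ls

_⊨*_ : Model → List LTL → Set
σ ⊨* cs = All (λ C → σ , 0 ⊨ ALWAYS C) cs

_⊨_⇛_ : Model → Atom → LTL → Set
σ ⊨ x ⇛ φ = ∀ i → T (σ i x) → σ , i ⊨ φ

⇛-resp-≈ : ∀ A {σ τ x n} → σ ≈[ n ] τ → x < n → maxAtom A < n → σ ⊨ x ⇛ emb A → τ ⊨ x ⇛ emb A
⇛-resp-≈ A σ≈τ x<n A<n x⇒a i xᵢ = ⊨-resp-≈ A σ≈τ A<n (x⇒a i (T-resp-≈ (≈-sym σ≈τ) x<n xᵢ))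

module _ {σ : Model} {i : ℕ} where

  disjF⇒ : ∀ l ls → σ , i ⊨ disjF l ls → σ , i ⊨∨ l ∷ ls
  disjF⇒ l []       l′        = here l′
  disjF⇒ l (m ∷ ms) (inj₁ l′) = here l′
  disjF⇒ l (m ∷ ms) (inj₂ d)  = there (disjF⇒ m ms d)

  disjF⇐ : ∀ l ls → σ , i ⊨∨ l ∷ ls → σ , i ⊨ disjF l ls
  disjF⇐ l []       (here l′) = l′
  disjF⇐ l (m ∷ ms) (here l′) = inj₁ l′
  disjF⇐ l (m ∷ ms) (there d) = inj₂ (disjF⇐ m ms d)

  disjF-negL⇒ : ∀ {x} ls → σ , i ⊨ disjF (negL x) ls → T (σ i x) → σ , i ⊨∨ ls
  disjF-negL⇒ []       ¬x        x = ⊥-elim (¬x x)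
  disjF-negL⇒ (m ∷ ms) (inj₁ ¬x) x = ⊥-elim (¬x x)
  disjF-negL⇒ (m ∷ ms) (inj₂ d)  _ = disjF⇒ m ms d

  disjF-negL⇐ : ∀ {x} ls → (T (σ i x) → σ , i ⊨∨ ls) → σ , i ⊨ disjF (negL x) ls
  disjF-negL⇐ []       x⇒d x = case x⇒d x of λ ()
  disjF-negL⇐ {x} (m ∷ ms) x⇒d with T? (σ i x)
  ... | yes x = inj₂ (disjF⇐ m ms (x⇒d x))
  ... | no ¬x = inj₁ ¬x

module _ {σ : Model} {x : Atom} where

  rule5-elim : ∀ ls → σ ⊨* rule5 x ls → ∀ i → T (σ i x) → σ , i ⊨∨ ls
  rule5-elim ls (initially ∷ later ∷ []) zero    = disjF-negL⇒ ls (initially 0 z≤n refl)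
  rule5-elim ls (initially ∷ later ∷ []) (suc i) = disjF-negL⇒ ls (later i z≤n tt)

  rule5-intro : ∀ ls → (∀ i → T (σ i x) → σ , i ⊨∨ ls) → σ ⊨* rule5 x ls
  rule5-intro ls x⇒d = (λ j _ _ → disjF-negL⇐ ls (x⇒d j)) ∷ (λ j _ _ → disjF-negL⇐ ls (x⇒d (suc j))) ∷ []

  step-elim : ∀ l ls → σ , 0 ⊨ ALWAYS (stepC x l ls) → ∀ i → T (σ i x) → σ , suc i ⊨∨ l ∷ ls
  step-elim l ls x⇒○d i xᵢ = disjF⇒ l ls (x⇒○d i z≤n xᵢ)

  step-intro : ∀ l ls → (∀ i → T (σ i x) → σ , suc i ⊨∨ l ∷ ls) → σ , 0 ⊨ ALWAYS (stepC x l ls)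
  step-intro l ls x⇒○d i _ xᵢ = disjF⇐ l ls (x⇒○d i xᵢ)

rule5true-holds : ∀ {σ} → σ ⊨* rule5true
rule5true-holds = (λ _ _ _ → tt) ∷ (λ _ _ _ → tt) ∷ []

factor-∨ : ∀ {σ i a b m} → σ , i ⊨∨ a ∷ m ∷ [] → σ , i ⊨∨ b ∷ m ∷ [] →
           (σ , i ⊨ litF a × σ , i ⊨ litF b) ⊎ σ , i ⊨ litF m
factor-∨ (there (here m)) _                = inj₂ m
factor-∨ (here a)         (there (here m)) = inj₂ m
factor-∨ (here a)         (here b)         = inj₁ (a , b)

litOf-sound : ∀ A {l} → litOf A ≡ just l → emb A ≡ litF l × atomOf l ≤ maxAtom A
litOf-sound (atom p)           refl = refl , ≤-refl
litOf-sound (NOT (atom p))     refl = refl , ≤-refl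
litOf-sound TRUE               ()
litOf-sound FALSE              ()
litOf-sound (NOT TRUE)         ()
litOf-sound (NOT FALSE)        ()
litOf-sound (NOT (NOT _))      ()
litOf-sound (NOT (OR _ _))     ()
litOf-sound (NOT (AND _ _))    ()
litOf-sound (NOT (IMP _ _))    ()
litOf-sound (NOT (NEXT _))     ()
litOf-sound (NOT (SOMETIME _)) ()
litOf-sound (NOT (ALWAYS _))   ()
litOf-sound (NOT (UNTIL _ _))  ()
litOf-sound (NOT (UNLESS _ _)) ()
litOf-sound (OR _ _)           ()
litOf-sound (AND _ _)          ()
litOf-sound (IMP _ _)          ()
litOf-sound (NEXT _)           ()
litOf-sound (SOMETIME _)       ()
litOf-sound (ALWAYS _)         ()
litOf-sound (UNTIL _ _)        ()
litOf-sound (UNLESS _ _)       ()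

dlits-sound : ∀ A {l ls σ i} → dlits A ≡ just (l , ls) → σ , i ⊨ emb A ⇔ σ , i ⊨∨ l ∷ ls
dlits-sound (OR A B) eq with dlits A in eqA | dlits B in eqB
dlits-sound (OR A B) {σ = σ} {i} refl | just (l , ls) | just (m , ms) = mk⇔ to from
  where
  to : σ , i ⊨ emb (OR A B) → σ , i ⊨∨ l ∷ ls ++ m ∷ ms
  to (inj₁ a) = Any.++⁺ˡ (Equivalence.to (dlits-sound A eqA) a)
  to (inj₂ b) = Any.++⁺ʳ (l ∷ ls) (Equivalence.to (dlits-sound B eqB) b)
  from : σ , i ⊨∨ l ∷ ls ++ m ∷ ms → σ , i ⊨ emb (OR A B)
  from d = Sum.map (Equivalence.from (dlits-sound A eqA)) (Equivalence.from (dlits-sound B eqB)) (Any.++⁻ (l ∷ ls) d)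
dlits-sound (OR A B) () | just _  | nothing
dlits-sound (OR A B) () | nothing | _
dlits-sound (atom p) refl = mk⇔ here Any.singleton⁻
dlits-sound (NOT A) eq with litOf (NOT A) in e
dlits-sound (NOT A) {σ = σ} {i} refl | just l =
  mk⇔ (λ a → here (subst (σ , i ⊨_) A≡l a)) (λ d → subst (σ , i ⊨_) (sym A≡l) (Any.singleton⁻ d))
  where
  A≡l : emb (NOT A) ≡ litF l
  A≡l = proj₁ (litOf-sound (NOT A) e)
dlits-sound (NOT A) () | nothing
dlits-sound TRUE         ()
dlits-sound FALSE        ()
dlits-sound (AND _ _)    ()
dlits-sound (IMP _ _)    ()
dlits-sound (NEXT _)     ()
dlits-sound (SOMETIME _) ()
dlits-sound (ALWAYS _)   ()
dlits-sound (UNTIL _ _)  ()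
dlits-sound (UNLESS _ _) ()

asDisjunct : (Lit × List LTL) × ℕ → (List Lit × List LTL) × ℕ
asDisjunct ((l , cs) , n) = (l ∷ [] , cs) , n

data DisjunctView : Fml → Set where
  disjunction : ∀ A B → DisjunctView (OR A B)
  disjunct    : ∀ {A} → (∀ n → dP A n ≡ asDisjunct (litArg A n)) → DisjunctView A

disjunctView : ∀ A → DisjunctView A
disjunctView (OR A B)     = disjunction A B
disjunctView (atom p)     = disjunct (λ _ → refl)
disjunctView TRUE         = disjunct (λ _ → refl)
disjunctView FALSE        = disjunct (λ _ → refl)
disjunctView (NOT A)      = disjunct negation
  where
  negation : ∀ n → dP (NOT A) n ≡ asDisjunct (litArg (NOT A) n)
  negation n with litOf (NOT A)
  ... | just _  = refl
  ... | nothing = refl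
disjunctView (AND A B)    = disjunct (λ _ → refl)
disjunctView (IMP A B)    = disjunct (λ _ → refl)
disjunctView (NEXT A)     = disjunct (λ _ → refl)
disjunctView (SOMETIME A) = disjunct (λ _ → refl)
disjunctView (ALWAYS A)   = disjunct (λ _ → refl)
disjunctView (UNTIL A B)  = disjunct (λ _ → refl)
disjunctView (UNLESS A B) = disjunct (λ _ → refl)

-- pos y (NOT A) is neg y A, and litOf (NOT (atom p)) is the literal negL p.
dN≡litArg-NOT : ∀ A n → dN A n ≡ asDisjunct (litArg (NOT A) n)
dN≡litArg-NOT (atom p)     n = refl
dN≡litArg-NOT TRUE         n = refl
dN≡litArg-NOT FALSE        n = refl
dN≡litArg-NOT (NOT A)      n = refl
dN≡litArg-NOT (OR A B)     n = refl
dN≡litArg-NOT (AND A B)    n = refl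
dN≡litArg-NOT (IMP A B)    n = refl
dN≡litArg-NOT (NEXT A)     n = refl
dN≡litArg-NOT (SOMETIME A) n = refl
dN≡litArg-NOT (ALWAYS A)   n = refl
dN≡litArg-NOT (UNTIL A B)  n = refl
dN≡litArg-NOT (UNLESS A B) n = refl

LitImplies : Model → Pred ℕ 0ℓ → Lit × List LTL → Set
LitImplies σ P (l , cs) = σ ⊨* cs → ∀ i → σ , i ⊨ litF l → P i

DisjImplies : Model → Pred ℕ 0ℓ → List Lit × List LTL → Set
DisjImplies σ P (ls , cs) = σ ⊨* cs → ∀ i → σ , i ⊨∨ ls → P i

asDisjunct-complete : ∀ {σ P l cs} → LitImplies σ P (l , cs) → DisjImplies σ P (l ∷ [] , cs)
asDisjunct-complete l⇒P cs i d = l⇒P cs i (Any.singleton⁻ d)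

litArg-complete : ∀ A n {σ} → (σ ⊨* proj₁ (pos n A (suc n)) → σ ⊨ n ⇛ emb A) →
                  LitImplies σ (σ ,_⊨ emb A) (proj₁ (litArg A n))
litArg-complete A n {σ} y⇒a with litOf A in e
... | just l  = λ _ i lᵢ → subst (σ , i ⊨_) (sym (proj₁ (litOf-sound A e))) lᵢ
... | nothing = y⇒a

disjunction-complete : ∀ {σ P Q L₁ L₂ c₁ c₂} → DisjImplies σ P (L₁ , c₁) → DisjImplies σ Q (L₂ , c₂) →
                       DisjImplies σ (P ∪ Q) (L₁ ++ L₂ , c₁ ++ c₂)
disjunction-complete {L₁ = L₁} {c₁ = c₁} L₁⇒P L₂⇒Q cs i d =
  let (cs₁ , cs₂) = All.++⁻ c₁ cs in Sum.map (L₁⇒P cs₁ i) (L₂⇒Q cs₂ i) (Any.++⁻ L₁ d)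

module _ {σ : Model} {x : Atom} where

  rule5-complete : ∀ {P L cs} → DisjImplies σ P (L , cs) → σ ⊨* rule5 x L ++ cs → ∀ i → T (σ i x) → P i
  rule5-complete {L = L} L⇒P cs′ i xᵢ = let (r , cs) = All.++⁻ (rule5 x L) cs′ in L⇒P cs i (rule5-elim {σ} L r i xᵢ)

  conj-complete : ∀ {P Q : Pred ℕ 0ℓ} c₁ {c₂} → (σ ⊨* c₁ → ∀ i → T (σ i x) → P i) →
                  (σ ⊨* c₂ → ∀ i → T (σ i x) → Q i) → σ ⊨* c₁ ++ c₂ → ∀ i → T (σ i x) → P i × Q i
  conj-complete c₁ x⇒P x⇒Q cs i xᵢ = let (cs₁ , cs₂) = All.++⁻ c₁ cs in x⇒P cs₁ i xᵢ , x⇒Q cs₂ i xᵢ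

  boxLit-complete : ∀ l n → σ ⊨* proj₁ (boxLit x l n) → σ ⊨ x ⇛ ALWAYS (litF l)
  boxLit-complete l n (l₀ ∷ l₁ ∷ y₀ ∷ y₁ ∷ y⇒○l ∷ y⇒○y ∷ []) i xᵢ =
    always-by-invariant {Y = λ j → T (σ j n)}
      (Any.singleton⁻ (rule5-elim {σ} (l ∷ []) (l₀ ∷ l₁ ∷ []) i xᵢ) ,
       Any.singleton⁻ (rule5-elim {σ} (posL n ∷ []) (y₀ ∷ y₁ ∷ []) i xᵢ))
      (λ j yⱼ → Any.singleton⁻ (step-elim {σ} l [] y⇒○l j yⱼ) ,
                Any.singleton⁻ (step-elim {σ} (posL n) [] y⇒○y j yⱼ))

  module _ {y : Atom} {P : Pred ℕ 0ℓ} {cs : List LTL} (y⇒P : σ ⊨* cs → ∀ i → T (σ i y) → P i) where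

    next-complete : σ ⊨* stepC x (posL y) [] ∷ cs → ∀ i → T (σ i x) → P (suc i)
    next-complete (x⇒○y ∷ cs) i xᵢ = y⇒P cs (suc i) (x⇒○y i z≤n xᵢ)

    sometime-complete : σ ⊨* evC x (posL y) ∷ cs → ∀ i → T (σ i x) → Eventually P i
    sometime-complete (x⇒◇y ∷ cs) i xᵢ = let (k , i≤k , yₖ) = x⇒◇y i z≤n xᵢ in k , i≤k , y⇒P cs k yₖ

    always-complete : ∀ n → σ ⊨* proj₁ (boxLit x (posL y) n) ++ cs → ∀ i → T (σ i x) → Always P i
    always-complete n cs′ i xᵢ j i≤j =
      let (box , cs) = All.++⁻ (proj₁ (boxLit x (posL y) n)) cs′
      in y⇒P cs j (boxLit-complete (posL y) n box i xᵢ j i≤j)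

  module _ {𝕆 : BinaryOp} (𝕆-mono : Monotone 𝕆) where

    binary-complete : ∀ {P Q} g r₁ r₂ →
                      (σ ⊨* g → ∀ i → T (σ i x) → 𝕆 (σ ,_⊨ litF (proj₁ r₁)) (σ ,_⊨ litF (proj₁ r₂)) i) →
                      LitImplies σ P r₁ → LitImplies σ Q r₂ →
                      σ ⊨* g ++ proj₂ r₁ ++ proj₂ r₂ → ∀ i → T (σ i x) → 𝕆 P Q i
    binary-complete g (l , c₁) (m , c₂) x⇒l𝕆m l⇒P m⇒Q cs i xᵢ =
      let (cs₃ , cs₁₂) = All.++⁻ g cs
          (cs₁ , cs₂)  = All.++⁻ c₁ cs₁₂
      in 𝕆-mono (l⇒P cs₁ _) (m⇒Q cs₂ _) (x⇒l𝕆m cs₃ i xᵢ)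

    negated-binary-complete : ∀ {P Q : Pred ℕ 0ℓ} {y z v} c₁ c₂ {c₃} →
                              (σ ⊨* c₁ → ∀ i → T (σ i x) → 𝕆 (λ j → T (σ j y)) (λ j → T (σ j v)) i) →
                              (σ ⊨* c₂ → ∀ i → T (σ i y) → ∁ Q i) → (σ ⊨* c₃ → ∀ i → T (σ i z) → ∁ P i) →
                              σ ⊨* c₁ ++ c₂ ++ rule5 v (posL y ∷ []) ++ rule5 v (posL z ∷ []) ++ c₃ →
                              ∀ i → T (σ i x) → 𝕆 (∁ Q) (∁ P ∩ ∁ Q) i
    negated-binary-complete {P} {Q} {y} {z} {v} c₁ c₂ x⇒y𝕆v y⇒¬Q z⇒¬P cs i xᵢ =
      let (cs₁ , cs′)  = All.++⁻ c₁ cs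
          (cs₂ , cs″)  = All.++⁻ c₂ cs′
          (v⇒y , cs‴) = All.++⁻ (rule5 v (posL y ∷ [])) cs″
          (v⇒z , cs₃)  = All.++⁻ (rule5 v (posL z ∷ [])) cs‴
          v⇒¬P∩¬Q : ∀ {j} → T (σ j v) → (∁ P ∩ ∁ Q) j
          v⇒¬P∩¬Q vⱼ = z⇒¬P cs₃ _ (Any.singleton⁻ (rule5-elim {σ} _ v⇒z _ vⱼ)) ,
                        y⇒¬Q cs₂ _ (Any.singleton⁻ (rule5-elim {σ} _ v⇒y _ vⱼ))
      in 𝕆-mono (y⇒¬Q cs₂ _) v⇒¬P∩¬Q (x⇒y𝕆v cs₁ i xᵢ)

-- Q is required of every model that agrees with the new one below n′, because
-- the later steps of the translation redefine exactly the symbols from n′ on.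
record Extension (σ : Model) (n n′ : ℕ) (Q : Model → Set) : Set where
  constructor extension
  field
    model    : Model
    agrees   : σ ≈[ n ] model
    n≤n′     : n ≤ n′
    realises : ∀ τ → model ≈[ n′ ] τ → Q τ

module _ {σ : Model} {n : ℕ} where

  ext-pure : ∀ {Q} → (∀ τ → σ ≈[ n ] τ → Q τ) → Extension σ n n Q
  ext-pure q = extension σ ≈-refl ≤-refl q

  ext-map : ∀ {n′ Q R} → (∀ τ → σ ≈[ n ] τ → n ≤ n′ → Q τ → R τ) → Extension σ n n′ Q → Extension σ n n′ R
  ext-map f (extension σ′ σ≈σ′ n≤n′ q) =
    extension σ′ σ≈σ′ n≤n′ (λ τ σ′≈τ → f τ (≈-trans≤ σ≈σ′ n≤n′ σ′≈τ) n≤n′ (q τ σ′≈τ))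

  ext-bind : ∀ {n₁ n₂ Q R} → Extension σ n n₁ Q →
             (∀ {σ₁} → σ ≈[ n ] σ₁ → n ≤ n₁ → (∀ τ → σ₁ ≈[ n₁ ] τ → Q τ) → Extension σ₁ n₁ n₂ R) →
             Extension σ n n₂ (λ τ → Q τ × R τ)
  ext-bind (extension σ₁ σ≈σ₁ n≤n₁ q) k with k σ≈σ₁ n≤n₁ q
  ... | extension σ₂ σ₁≈σ₂ n₁≤n₂ r =
    extension σ₂ (≈-trans≤ σ≈σ₁ n≤n₁ σ₁≈σ₂) (≤-trans n≤n₁ n₁≤n₂)
              (λ τ σ₂≈τ → q τ (≈-trans≤ σ₁≈σ₂ n₁≤n₂ σ₂≈τ) , r τ σ₂≈τ)

  ext-update : ∀ {n′ Q} b → Extension (update σ n b) (suc n) n′ Q → Extension σ n n′ Q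
  ext-update b (extension σ′ σ≈σ′ n<n′ q) =
    extension σ′ (≈-trans≤ update-≈ (n≤1+n n) σ≈σ′) (≤-trans (n≤1+n n) n<n′) q

  ext-++ : ∀ {n₁ n₂ c₁ c₂} → Extension σ n n₁ (_⊨* c₁) →
           (∀ {σ₁} → σ ≈[ n ] σ₁ → n ≤ n₁ → Extension σ₁ n₁ n₂ (_⊨* c₂)) → Extension σ n n₂ (_⊨* c₁ ++ c₂)
  ext-++ e k = ext-map (λ _ _ _ (cs₁ , cs₂) → All.++⁺ cs₁ cs₂) (ext-bind e (λ σ≈σ₁ n≤n₁ _ → k σ≈σ₁ n≤n₁))

ext-model : ∀ {σ n n′ Q} → Extension σ n n′ Q → Σ Model Q
ext-model (extension τ _ _ q) = τ , q τ ≈-refl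

Extensible : Model → ℕ → List LTL × ℕ → Set
Extensible σ n (cs , n′) = Extension σ n n′ (_⊨* cs)

Sound : Atom → Fml → M (List LTL) → Set
Sound x A c = ∀ {σ n} → x < n → maxAtom A < n → σ ⊨ x ⇛ emb A → Extensible σ n (c n)

LitRealises : Model → ℕ → Fml → (Lit × List LTL) × ℕ → Set
LitRealises σ n A ((l , cs) , n′) =
  Extension σ n n′ (λ τ → τ ⊨* cs × atomOf l < n′ × (∀ i → σ , i ⊨ emb A → τ , i ⊨ litF l))

DisjRealises : Model → ℕ → Fml → (List Lit × List LTL) × ℕ → Set
DisjRealises σ n A ((ls , cs) , n′) = Extension σ n n′ (λ τ → τ ⊨* cs × (∀ i → σ , i ⊨ emb A → τ , i ⊨∨ ls))

DisjSound : Fml → M (List Lit × List LTL) → Set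
DisjSound A d = ∀ {σ n} → maxAtom A < n → DisjRealises σ n A (d n)

asDisjunct-sound : ∀ {σ n} A r → LitRealises σ n A r → DisjRealises σ n A (asDisjunct r)
asDisjunct-sound _ _ = ext-map (λ _ _ _ (cs , _ , a⇒l) → cs , λ i a → here (a⇒l i a))

conj-sound : ∀ {x} A B {c₁ c₂ : M (List LTL)} → Sound x A c₁ → Sound x B c₂ →
             Sound x (AND A B) (c₁ >>= λ cs₁ → c₂ >>= λ cs₂ → return (cs₁ ++ cs₂))
conj-sound A B x⇒A-sound x⇒B-sound {n = n} x<n AB<n x⇒a∧b =
  ext-++ (x⇒A-sound x<n A<n (λ i xᵢ → proj₁ (x⇒a∧b i xᵢ))) λ σ≈σ₁ n≤n₁ →
    x⇒B-sound (<-≤-trans x<n n≤n₁) (<-≤-trans B<n n≤n₁) (⇛-resp-≈ B σ≈σ₁ x<n B<n (λ i xᵢ → proj₂ (x⇒a∧b i xᵢ)))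
  where
  A<n : maxAtom A < n
  A<n = m⊔n<o⇒m<o _ _ AB<n
  B<n : maxAtom B < n
  B<n = m⊔n<o⇒n<o _ _ AB<n

disjunction-sound : ∀ {σ n n₁ n₂ L₁ L₂ c₁ c₂} A B → maxAtom A ⊔ maxAtom B < n →
                    DisjRealises σ n A ((L₁ , c₁) , n₁) → (∀ {σ₁} → n ≤ n₁ → DisjRealises σ₁ n₁ B ((L₂ , c₂) , n₂)) →
                    DisjRealises σ n (OR A B) ((L₁ ++ L₂ , c₁ ++ c₂) , n₂)
disjunction-sound {L₁ = L₁} A B AB<n realise₁ realise₂ =
  ext-map (λ { _ _ _ ((cs₁ , a⇒L₁) , (cs₂ , b⇒L₂)) →
               All.++⁺ cs₁ cs₂ , λ i → Sum.[ (λ a → Any.++⁺ˡ (a⇒L₁ i a)) , (λ b → Any.++⁺ʳ L₁ (b⇒L₂ i b)) ] })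
    (ext-bind realise₁ λ σ≈σ₁ n≤n₁ _ →
      ext-map (λ { _ _ _ (cs₂ , b⇒L₂) → cs₂ , λ i b → b⇒L₂ i (⊨-resp-≈ B σ≈σ₁ (m⊔n<o⇒n<o _ _ AB<n) b) })
              (realise₂ n≤n₁))

rule5-sound : ∀ {σ x n n′ L cs} A → x < n → σ ⊨ x ⇛ emb A → DisjRealises σ n A ((L , cs) , n′) →
              Extension σ n n′ (_⊨* rule5 x L ++ cs)
rule5-sound {L = L} A x<n x⇒a =
  ext-map λ { τ σ≈τ _ (cs , a⇒L) →
              All.++⁺ (rule5-intro {τ} L λ i xᵢ → a⇒L i (x⇒a i (T-resp-≈ (≈-sym σ≈τ) x<n xᵢ))) cs }

module Classical (lem : ExcludedMiddle 0ℓ) where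

  dne : {A : Set} → ¬ ¬ A → A
  dne = em⇒dne lem

  implication : {A B : Set} → (A → B) → ¬ A ⊎ B
  implication {A} a⇒b with lem {A}
  ... | yes a = inj₂ (a⇒b a)
  ... | no ¬a = inj₁ ¬a

  ¬implication : {A B : Set} → ¬ (A → B) → A × ¬ B
  ¬implication ¬a⇒b = dne (λ ¬a → ¬a⇒b (λ a → ⊥-elim (¬a a))) , (λ b → ¬a⇒b (λ _ → b))

  ¬conjunction : {A B : Set} → ¬ (A × B) → ¬ A ⊎ ¬ B
  ¬conjunction {A} ¬a∧b with lem {A}
  ... | yes a = inj₂ (λ b → ¬a∧b (a , b))
  ... | no ¬a = inj₁ ¬a

  first-or-never : ∀ (P : Pred ℕ 0ℓ) i → Always (∁ P) i ⊎ Until (∁ P) P i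
  first-or-never P i with lem {Eventually P i}
  ... | no ¬ev = inj₁ (λ j i≤j p → ¬ev (j , i≤j , p))
  ... | yes (k , i≤k , p) = inj₂ (first-within (k ∸ i) (subst P (sym (m∸n+n≡m i≤k)) p))
    where
    first-within : ∀ d {i} → P (d + i) → Until (∁ P) P i
    first-within d {i} p with lem {P i}
    ... | yes pᵢ = i , ≤-refl , pᵢ , λ j i≤j j<i → ⊥-elim (<⇒≱ j<i i≤j)
    first-within zero    p | no ¬pᵢ = ⊥-elim (¬pᵢ p)
    first-within (suc d) {i} p | no ¬pᵢ = until-cons ¬pᵢ (first-within d (subst P (sym (+-suc d i)) p))

  ¬always⇒eventually : ∀ {P : Pred ℕ 0ℓ} {i} → ¬ Always P i → Eventually (∁ P) i
  ¬always⇒eventually ¬a = dne (λ ¬ev → ¬a (λ j i≤j → dne (λ ¬p → ¬ev (j , i≤j , ¬p))))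

  module _ {P Q : Pred ℕ 0ℓ} {i : ℕ} where

    ¬until-at-first-violation : ¬ Until P Q i → Until (∁ (Q ∪ ∁ P)) (Q ∪ ∁ P) i → Until (∁ Q) (∁ P ∩ ∁ Q) i
    ¬until-at-first-violation ¬u (k , i≤k , q∨¬p , before) =
      k , i≤k , (¬p , ¬q) , λ j i≤j j<k q → before j i≤j j<k (inj₁ q)
      where
      ¬q : ¬ Q k
      ¬q q = ¬u (k , i≤k , q , λ j i≤j j<k → dne (λ ¬p → before j i≤j j<k (inj₂ ¬p)))
      ¬p : ¬ P k
      ¬p p = [ ¬q , (λ ¬p → ¬p p) ]′ q∨¬p

    ¬until⇒unless : ¬ Until P Q i → Unless (∁ Q) (∁ P ∩ ∁ Q) i
    ¬until⇒unless ¬u with first-or-never (Q ∪ ∁ P) i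
    ... | inj₁ never = inj₂ (λ j i≤j q → never j i≤j (inj₁ q))
    ... | inj₂ first = inj₁ (¬until-at-first-violation ¬u first)

    ¬unless⇒until : ¬ Unless P Q i → Until (∁ Q) (∁ P ∩ ∁ Q) i
    ¬unless⇒until ¬w with first-or-never (Q ∪ ∁ P) i
    ... | inj₁ never = ⊥-elim (¬w (inj₂ (λ j i≤j → dne (λ ¬p → never j i≤j (inj₂ ¬p)))))
    ... | inj₂ first = ¬until-at-first-violation (λ u → ¬w (inj₁ u)) first

  unless-by-invariant : ∀ {P Q Y : Pred ℕ 0ℓ} {i} → ((P ∩ Y) ∪ Q) i → (∀ j → Y j → ((P ∩ Y) ∪ Q) (suc j)) →
                        Unless P Q i
  unless-by-invariant {Q = Q} {i = i} start step with first-or-never Q i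
  ... | inj₁ never = inj₂ λ j i≤j →
          proj₁ (invariant-while start step (≤⇒≤′ i≤j) (λ k i≤k _ → never k i≤k))
  ... | inj₂ (k , i≤k , q , before) = inj₁ (k , i≤k , q , λ j i≤j j<k →
          proj₁ (invariant-while start step (≤⇒≤′ i≤j) (λ k′ i≤k′ k′≤j → before k′ i≤k′ (≤-<-trans k′≤j j<k))))

  truth : Pred ℕ 0ℓ → ℕ → Bool
  truth P i = isYes (lem {P i})

  record Names (τ : Model) (y : Atom) (P : Pred ℕ 0ℓ) : Set where
    field
      named⇒ : ∀ {i} → T (τ i y) → P i
      named⇐ : ∀ {i} → P i → T (τ i y)

  open Names public

  defined : ∀ {σ y m τ} {P : Pred ℕ 0ℓ} → update σ y (truth P) ≈[ m ] τ → y < m → Names τ y P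
  defined {σ} {y} {τ = τ} {P} σ′≈τ y<m = record
    { named⇒ = λ {i} yᵢ → toWitness {a? = lem} (subst T (sym (value i)) yᵢ)
    ; named⇐ = λ {i} pᵢ → subst T (value i) (fromWitness {a? = lem} pᵢ)
    }
    where
    value : ∀ i → truth P i ≡ τ i y
    value i = trans (sym (update-≡ σ y (truth P) i)) (agree-at σ′≈τ y y<m i)

  ext-define : ∀ {σ n n′ Q} (P : Pred ℕ 0ℓ) →
               (∀ {σ′} → σ ≈[ n ] σ′ → (∀ {τ} → σ′ ≈[ suc n ] τ → Names τ n P) → Extension σ′ (suc n) n′ Q) →
               Extension σ n n′ Q
  ext-define {n = n} P k = ext-update (truth P) (k update-≈ (λ σ′≈τ → defined σ′≈τ (n<1+n n)))

  ext-name : ∀ {σ n Q} (P : Pred ℕ 0ℓ) → (∀ τ → σ ≈[ n ] τ → Names τ n P → Q τ) → Extension σ n (suc n) Q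
  ext-name {n = n} P q = ext-define P λ σ≈σ′ named →
    ext-pure (λ τ σ′≈τ → q τ (≈-trans≤ σ≈σ′ (n≤1+n n) σ′≈τ) (named σ′≈τ))

  unlessLit-complete : ∀ {σ} x l m n → σ ⊨* proj₁ (unlessLit x l m n) → σ ⊨ x ⇛ UNLESS (litF l) (litF m)
  unlessLit-complete {σ} x l m n (r₀ ∷ r₁ ∷ y₀ ∷ y₁ ∷ y⇒○l∨m ∷ y⇒○y∨m ∷ []) i xᵢ =
    unless-by-invariant {Y = λ j → T (σ j n)}
      (factor-∨ (rule5-elim {σ} (l ∷ m ∷ []) (r₀ ∷ r₁ ∷ []) i xᵢ)
                (rule5-elim {σ} (posL n ∷ m ∷ []) (y₀ ∷ y₁ ∷ []) i xᵢ))
      (λ j yⱼ → factor-∨ (step-elim {σ} l (m ∷ []) y⇒○l∨m j yⱼ) (step-elim {σ} (posL n) (m ∷ []) y⇒○y∨m j yⱼ))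

  untilLit-complete : ∀ {σ} x l m n → σ ⊨* proj₁ (untilLit x l m n) → σ ⊨ x ⇛ UNTIL (litF l) (litF m)
  untilLit-complete x l m n (x⇒◇m ∷ cs) i xᵢ = until-of-unless (unlessLit-complete x l m n cs i xᵢ) (x⇒◇m i z≤n xᵢ)

  boxLit-sound : ∀ {σ n} x l → x < n → atomOf l < n → σ ⊨ x ⇛ ALWAYS (litF l) →
                 Extension σ n (suc n) (_⊨* proj₁ (boxLit x l n))
  boxLit-sound {σ} {n} x l x<n l<n x⇒□l = ext-name □l clauses
    where
    □l : Pred ℕ 0ℓ
    □l = Always (σ ,_⊨ litF l)
    clauses : ∀ τ → σ ≈[ n ] τ → Names τ n □l → τ ⊨* proj₁ (boxLit x l n)
    clauses τ σ≈τ y≡□l =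
      All.++⁺ (rule5-intro {τ} (l ∷ []) λ i xᵢ → here (lit-resp-≈ l σ≈τ l<n (□l-at xᵢ i ≤-refl)))
      (All.++⁺ (rule5-intro {τ} (posL n ∷ []) λ i xᵢ → here (named⇐ y≡□l (□l-at xᵢ)))
        (step-intro {τ} l [] (λ j yⱼ → here (lit-resp-≈ l σ≈τ l<n (named⇒ y≡□l yⱼ (suc j) (n≤1+n j)))) ∷
         step-intro {τ} (posL n) [] (λ j yⱼ → here (named⇐ y≡□l λ k j<k → named⇒ y≡□l yⱼ k (<⇒≤ j<k))) ∷ []))
      where
      □l-at : ∀ {i} → T (τ i x) → □l i
      □l-at xᵢ = x⇒□l _ (T-resp-≈ (≈-sym σ≈τ) x<n xᵢ)

  -- The auxiliary symbol is read as (l W m) ∧ ¬m, which is what its two step clauses propagate.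
  unlessLit-sound : ∀ {σ n} x l m → x < n → atomOf l < n → atomOf m < n →
                    σ ⊨ x ⇛ UNLESS (litF l) (litF m) → Extension σ n (suc n) (_⊨* proj₁ (unlessLit x l m n))
  unlessLit-sound {σ} {n} x l m x<n l<n m<n x⇒lWm = ext-name Y clauses
    where
    Lₛ Mₛ Y : Pred ℕ 0ℓ
    Lₛ = σ ,_⊨ litF l
    Mₛ = σ ,_⊨ litF m
    Y  = Unless Lₛ Mₛ ∩ ∁ Mₛ
    clauses : ∀ τ → σ ≈[ n ] τ → Names τ n Y → τ ⊨* proj₁ (unlessLit x l m n)
    clauses τ σ≈τ y≡Y =
      All.++⁺ (rule5-intro {τ} (l ∷ m ∷ []) λ i xᵢ → l-or-m (unless-now (lWm-at xᵢ)))
      (All.++⁺ (rule5-intro {τ} (posL n ∷ m ∷ []) λ i xᵢ → y-or-m (lWm-at xᵢ))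
        (step-intro {τ} l (m ∷ []) (λ j yⱼ → l-or-m (unless-now (lWm-next yⱼ))) ∷
         step-intro {τ} (posL n) (m ∷ []) (λ j yⱼ → y-or-m (lWm-next yⱼ)) ∷ []))
      where
      lWm-at : ∀ {i} → T (τ i x) → Unless Lₛ Mₛ i
      lWm-at xᵢ = x⇒lWm _ (T-resp-≈ (≈-sym σ≈τ) x<n xᵢ)
      lWm-next : ∀ {j} → T (τ j n) → Unless Lₛ Mₛ (suc j)
      lWm-next yⱼ = let (lWm , ¬m) = named⇒ y≡Y yⱼ in unless-step lWm ¬m
      l-or-m : ∀ {i} → Lₛ i ⊎ Mₛ i → τ , i ⊨∨ l ∷ m ∷ []
      l-or-m (inj₁ lᵢ) = here (lit-resp-≈ l σ≈τ l<n lᵢ)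
      l-or-m (inj₂ mᵢ) = there (here (lit-resp-≈ m σ≈τ m<n mᵢ))
      y-or-m : ∀ {i} → Unless Lₛ Mₛ i → τ , i ⊨∨ posL n ∷ m ∷ []
      y-or-m {i} lWm with lem {Mₛ i}
      ... | yes mᵢ = there (here (lit-resp-≈ m σ≈τ m<n mᵢ))
      ... | no ¬mᵢ = here (named⇐ y≡Y (lWm , ¬mᵢ))

  untilLit-sound : ∀ {σ n} x l m → x < n → atomOf l < n → atomOf m < n →
                   σ ⊨ x ⇛ UNTIL (litF l) (litF m) → Extension σ n (suc n) (_⊨* proj₁ (untilLit x l m n))
  untilLit-sound {σ} {n} x l m x<n l<n m<n x⇒lUm =
    ext-map (λ τ σ≈τ _ cs → x⇒◇m τ σ≈τ ∷ cs) (unlessLit-sound x l m x<n l<n m<n (λ i xᵢ → inj₁ (x⇒lUm i xᵢ)))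
    where
    x⇒◇m : ∀ τ → σ ≈[ n ] τ → τ , 0 ⊨ ALWAYS (evC x m)
    x⇒◇m τ σ≈τ j _ xⱼ =
      let (k , j≤k , mₖ , _) = x⇒lUm j (T-resp-≈ (≈-sym σ≈τ) x<n xⱼ) in k , j≤k , lit-resp-≈ m σ≈τ m<n mₖ

  mutual
    pos-complete : ∀ x A n {σ} → σ ⊨* proj₁ (pos x A n) → σ ⊨ x ⇛ emb A
    pos-complete x (atom p)     n {σ} cs i xᵢ = Any.singleton⁻ (rule5-elim {σ} (posL p ∷ []) cs i xᵢ)
    pos-complete x TRUE         n     cs i xᵢ = tt
    pos-complete x FALSE        n {σ} cs i xᵢ = case rule5-elim {σ} [] cs i xᵢ of λ ()
    pos-complete x (NOT A)      n     = neg-complete x A n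
    pos-complete x (AND A B)    n     = conj-complete (proj₁ (pos x A n)) (pos-complete x A n) (pos-complete x B _)
    pos-complete x (OR A B)     n     = rule5-complete (disjunction-complete (dP-complete A n) (dP-complete B _))
    pos-complete x (IMP A B)    n     cs i xᵢ a =
      [ (λ ¬a → ⊥-elim (¬a a)) , (λ b → b) ]′
        (rule5-complete (disjunction-complete (dN-complete A n) (dP-complete B _)) cs i xᵢ)
    pos-complete x (NEXT A)     n {σ} with dlits A in e
    ... | just (l , ls) = λ { (x⇒○d ∷ []) i xᵢ → Equivalence.from (dlits-sound A e) (step-elim {σ} l ls x⇒○d i xᵢ) }
    ... | nothing       = next-complete (pos-complete n A (suc n))
    pos-complete x (SOMETIME A) n {σ} with litOf A in e
    ... | just l  = λ { (x⇒◇l ∷ []) i xᵢ → let (k , i≤k , lₖ) = x⇒◇l i z≤n xᵢ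
                                          in k , i≤k , subst (σ , k ⊨_) (sym (proj₁ (litOf-sound A e))) lₖ }
    ... | nothing = sometime-complete (pos-complete n A (suc n))
    pos-complete x (ALWAYS A)   n {σ} with litOf A in e
    ... | just l  = λ cs i xᵢ j i≤j →
                      subst (σ , j ⊨_) (sym (proj₁ (litOf-sound A e))) (boxLit-complete l n cs i xᵢ j i≤j)
    ... | nothing = always-complete (pos-complete n A (suc (suc n))) (suc n)
    pos-complete x (UNTIL A B)  n     =
      binary-complete until-mono (proj₁ (untilLit x _ _ _)) (proj₁ (litArg A n)) (proj₁ (litArg B _))
        (untilLit-complete x _ _ _)
        (litArg-complete A n (pos-complete n A (suc n))) (litArg-complete B _ (pos-complete _ B _))
    pos-complete x (UNLESS A B) n     =
      binary-complete unless-mono (proj₁ (unlessLit x _ _ _)) (proj₁ (litArg A n)) (proj₁ (litArg B _))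
        (unlessLit-complete x _ _ _)
        (litArg-complete A n (pos-complete n A (suc n))) (litArg-complete B _ (pos-complete _ B _))

    neg-complete : ∀ x A n {σ} → σ ⊨* proj₁ (neg x A n) → σ ⊨ x ⇛ NOT (emb A)
    neg-complete x (atom p)     n {σ} cs i xᵢ = Any.singleton⁻ (rule5-elim {σ} (negL p ∷ []) cs i xᵢ)
    neg-complete x TRUE         n {σ} cs i xᵢ _ = case rule5-elim {σ} [] cs i xᵢ of λ ()
    neg-complete x FALSE        n     cs i xᵢ ()
    neg-complete x (NOT A)      n     cs i xᵢ ¬a = ¬a (pos-complete x A n cs i xᵢ)
    neg-complete x (OR A B)     n     cs i xᵢ =
      let (¬a , ¬b) = conj-complete (proj₁ (neg x A n)) (neg-complete x A n) (neg-complete x B _) cs i xᵢ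
      in [ ¬a , ¬b ]′
    neg-complete x (IMP A B)    n     cs i xᵢ a⇒b =
      let (a , ¬b) = conj-complete (proj₁ (pos x A n)) (pos-complete x A n) (neg-complete x B _) cs i xᵢ
      in ¬b (a⇒b a)
    neg-complete x (AND A B)    n     cs i xᵢ (a , b) =
      [ (λ ¬a → ¬a a) , (λ ¬b → ¬b b) ]′
        (rule5-complete (disjunction-complete (dN-complete A n) (dN-complete B _)) cs i xᵢ)
    neg-complete x (NEXT A)     n     = next-complete (neg-complete n A (suc n))
    neg-complete x (ALWAYS A)   n     cs i xᵢ □a =
      let (k , i≤k , ¬aₖ) = sometime-complete (neg-complete n A (suc n)) cs i xᵢ in ¬aₖ (□a k i≤k)
    neg-complete x (SOMETIME A) n     cs i xᵢ (k , i≤k , aₖ) =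
      always-complete (neg-complete n A (suc (suc n))) (suc n) cs i xᵢ k i≤k aₖ
    neg-complete x (UNTIL A B)  n     cs i xᵢ =
      unless-excludes-until (negated-binary-complete unless-mono (proj₁ (unlessLit x _ _ _)) (proj₁ (neg n B _))
        (unlessLit-complete x _ _ _) (neg-complete n B _) (neg-complete (suc n) A _) cs i xᵢ)
    neg-complete x (UNLESS A B) n     cs i xᵢ =
      until-excludes-unless (negated-binary-complete until-mono (proj₁ (untilLit x _ _ _)) (proj₁ (neg n B _))
        (untilLit-complete x _ _ _) (neg-complete n B _) (neg-complete (suc n) A _) cs i xᵢ)

    dP-complete : ∀ A n {σ} → DisjImplies σ (σ ,_⊨ emb A) (proj₁ (dP A n))
    dP-complete A n {σ} with disjunctView A
    ... | disjunction B C = disjunction-complete (dP-complete B n) (dP-complete C _)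
    ... | disjunct dP≡    = subst (DisjImplies σ _) (cong proj₁ (sym (dP≡ n)))
                              (asDisjunct-complete (litArg-complete A n (pos-complete n A (suc n))))

    dN-complete : ∀ A n {σ} → DisjImplies σ (σ ,_⊨ NOT (emb A)) (proj₁ (dN A n))
    dN-complete A n {σ} = subst (DisjImplies σ _) (cong proj₁ (sym (dN≡litArg-NOT A n)))
                            (asDisjunct-complete (litArg-complete (NOT A) n (neg-complete n A (suc n))))

  rename-sound : ∀ A {σ n} {c : M (List LTL)} → Sound n A c → maxAtom A < n →
                 LitRealises σ n A ((posL n , proj₁ (c (suc n))) , proj₂ (c (suc n)))
  rename-sound A {σ} {n} y⇒A-sound A<n =
    ext-define (σ ,_⊨ emb A) λ σ≈σ′ y≡A →
      ext-map (λ τ σ′≈τ n<n′ cs → cs , n<n′ , λ i a → named⇐ (y≡A σ′≈τ) a)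
        (y⇒A-sound (n<1+n n) (m<n⇒m<1+n A<n) λ i yᵢ → ⊨-resp-≈ A σ≈σ′ A<n (named⇒ (y≡A ≈-refl) yᵢ))

  litArg-sound : ∀ A {σ n} → Sound n A (pos n A) → maxAtom A < n → LitRealises σ n A (litArg A n)
  litArg-sound A {σ} {n} y⇒A-sound A<n with litOf A in e
  ... | just l  = ext-pure λ τ σ≈τ → [] , l<n , λ i a → lit-resp-≈ l σ≈τ l<n (subst (σ , i ⊨_) A≡l a)
    where
    A≡l : emb A ≡ litF l
    A≡l = proj₁ (litOf-sound A e)
    l<n : atomOf l < n
    l<n = ≤-<-trans (proj₂ (litOf-sound A e)) A<n
  ... | nothing = rename-sound A y⇒A-sound A<n

  module _ {σ : Model} {x n : ℕ} (A : Fml) {c : M (List LTL)} (x<n : x < n) (A<n : maxAtom A < n)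
           (y⇒A-sound : Sound n A c) where

    next-sound : (∀ i → T (σ i x) → σ , suc i ⊨ emb A) →
                 Extensible σ n (stepC x (posL n) [] ∷ proj₁ (c (suc n)) , proj₂ (c (suc n)))
    next-sound x⇒○a =
      ext-map (λ { τ σ≈τ _ (cs , _ , a⇒y) → (λ i _ xᵢ → a⇒y (suc i) (x⇒○a i (T-resp-≈ (≈-sym σ≈τ) x<n xᵢ))) ∷ cs })
              (rename-sound A y⇒A-sound A<n)

    sometime-sound : (∀ i → T (σ i x) → Eventually (σ ,_⊨ emb A) i) →
                     Extensible σ n (evC x (posL n) ∷ proj₁ (c (suc n)) , proj₂ (c (suc n)))
    sometime-sound x⇒◇a =
      ext-map (λ { τ σ≈τ _ (cs , _ , a⇒y) →
                   (λ i _ xᵢ → let (k , i≤k , aₖ) = x⇒◇a i (T-resp-≈ (≈-sym σ≈τ) x<n xᵢ)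
                               in k , i≤k , a⇒y k aₖ) ∷ cs })
              (rename-sound A y⇒A-sound A<n)

    always-sound : (∀ i → T (σ i x) → Always (σ ,_⊨ emb A) i) →
                   Extensible σ n (proj₁ (boxLit x (posL n) (suc n)) ++ proj₁ (c (2 + n)) , proj₂ (c (2 + n)))
    always-sound x⇒□a =
      ext-define (σ ,_⊨ emb A) λ σ≈σ′ y≡A →
        ext-++ (boxLit-sound x (posL n) (m<n⇒m<1+n x<n) (n<1+n n) λ i xᵢ j i≤j →
                  named⇐ (y≡A ≈-refl) (x⇒□a i (T-resp-≈ (≈-sym σ≈σ′) x<n xᵢ) j i≤j))
               λ σ′≈σ″ _ → y⇒A-sound (m<n⇒m<1+n (n<1+n n)) (m<n⇒m<1+n (m<n⇒m<1+n A<n)) λ i yᵢ →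
                 ⊨-resp-≈ A (≈-trans≤ σ≈σ′ (n≤1+n n) σ′≈σ″) A<n (named⇒ (y≡A σ′≈σ″) yᵢ)

  module _ {𝕆 : BinaryOp} (𝕆-mono : Monotone 𝕆) (grp : Atom → Lit → Lit → M (List LTL))
           (grp-sound : ∀ {σ n} x l m → x < n → atomOf l < n → atomOf m < n →
                        (∀ i → T (σ i x) → 𝕆 (σ ,_⊨ litF l) (σ ,_⊨ litF m) i) → Extensible σ n (grp x l m n)) where

    binary-sound : ∀ {σ x n n₁ n₂ l m c₁ c₂} A B → x < n → maxAtom A ⊔ maxAtom B < n →
                   (∀ i → T (σ i x) → 𝕆 (σ ,_⊨ emb A) (σ ,_⊨ emb B) i) →
                   LitRealises σ n A ((l , c₁) , n₁) → (∀ {σ₁} → n ≤ n₁ → LitRealises σ₁ n₁ B ((m , c₂) , n₂)) →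
                   Extensible σ n (proj₁ (grp x l m n₂) ++ c₁ ++ c₂ , proj₂ (grp x l m n₂))
    binary-sound {x = x} {l = l} {m} A B x<n AB<n x⇒a𝕆b realise₁ realise₂ =
      ext-map (λ { _ _ _ ((cs₁ , _) , (cs₂ , g)) → All.++⁺ g (All.++⁺ cs₁ cs₂) })
        (ext-bind realise₁ λ σ≈σ₁ n≤n₁ realised₁ →
          ext-map (λ { _ _ _ ((cs₂ , _) , g) → cs₂ , g }) (ext-bind (realise₂ n≤n₁) λ σ₁≈σ₂ n₁≤n₂ realised₂ →
            let (_ , l<n₁ , a⇒l) = realised₁ _ σ₁≈σ₂
                (_ , m<n₂ , b⇒m) = realised₂ _ ≈-refl
                n≤n₂ = ≤-trans n≤n₁ n₁≤n₂
            in grp-sound x l m (<-≤-trans x<n n≤n₂) (<-≤-trans l<n₁ n₁≤n₂) m<n₂ λ i xᵢ →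
                 𝕆-mono (a⇒l _) (λ b → b⇒m _ (⊨-resp-≈ B σ≈σ₁ (m⊔n<o⇒n<o _ _ AB<n) b))
                        (x⇒a𝕆b i (T-resp-≈ (≈-sym (≈-trans≤ σ≈σ₁ n≤n₁ σ₁≈σ₂)) x<n xᵢ))))

    negatedClauses : Atom → ℕ → M (List LTL) → M (List LTL) → List LTL × ℕ
    negatedClauses x n cB cA =
      let (c₁ , n₁) = grp x (posL n) (posL (2 + n)) (3 + n)
          (c₂ , n₂) = cB n₁
          (c₃ , n₃) = cA n₂
      in c₁ ++ c₂ ++ rule5 (2 + n) (posL n ∷ []) ++ rule5 (2 + n) (posL (suc n) ∷ []) ++ c₃ , n₃

    -- The symbols n, n + 1 and n + 2 are the y, z and v of rule (2) for ¬(A U B) and ¬(A W B).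
    module _ {σ : Model} {x n : ℕ} (A B : Fml) {cB cA : M (List LTL)} (x<n : x < n) (AB<n : maxAtom A ⊔ maxAtom B < n)
             (x⇒¬b𝕆¬a¬b : ∀ i → T (σ i x) → 𝕆 (∁ (σ ,_⊨ emb B)) (∁ (σ ,_⊨ emb A) ∩ ∁ (σ ,_⊨ emb B)) i)
             (y⇒¬B-sound : Sound n (NOT B) cB) (z⇒¬A-sound : Sound (suc n) (NOT A) cA) where

      ¬A ¬B : Pred ℕ 0ℓ
      ¬A = ∁ (σ ,_⊨ emb A)
      ¬B = ∁ (σ ,_⊨ emb B)

      negated-binary-sound-named :
        ∀ {σ₃} → σ ≈[ n ] σ₃ →
        (∀ {τ} → σ₃ ≈[ 3 + n ] τ → Names τ n ¬B × Names τ (suc n) ¬A × Names τ (2 + n) (¬A ∩ ¬B)) →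
        Extensible σ₃ (3 + n) (negatedClauses x n cB cA)
      negated-binary-sound-named {σ₃} σ≈σ₃ names =
        ext-map (λ { τ σ₃≈τ _ (g , cs₂₃) →
                     let (cs₂ , cs₃) = All.++⁻ (proj₁ (cB _)) cs₂₃
                         (y≡¬B , z≡¬A , v≡¬A∩¬B) = names σ₃≈τ
                     in All.++⁺ g (All.++⁺ cs₂
                          (All.++⁺ (rule5-intro {τ} (posL n ∷ []) λ i vᵢ →
                                      here (named⇐ y≡¬B (proj₂ (named⇒ v≡¬A∩¬B vᵢ))))
                          (All.++⁺ (rule5-intro {τ} (posL (suc n) ∷ []) λ i vᵢ →
                                      here (named⇐ z≡¬A (proj₁ (named⇒ v≡¬A∩¬B vᵢ))))
                                   cs₃))) })
          (ext-bind group λ σ₃≈σ₄ 3+n≤n₁ _ →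
            ext-++ (y⇒¬B-sound (<-≤-trans n<3+n 3+n≤n₁) (<-≤-trans (<-≤-trans B<n (m≤n+m n 3)) 3+n≤n₁) λ i yᵢ →
                      ⊨-resp-≈ (NOT B) (≈-trans≤ σ≈σ₃ (m≤n+m n 3) σ₃≈σ₄) B<n (named⇒ (proj₁ (names σ₃≈σ₄)) yᵢ))
                   λ σ₄≈σ₅ n₁≤n₂ →
                     let 3+n≤n₂ = ≤-trans 3+n≤n₁ n₁≤n₂
                         σ₃≈σ₅  = ≈-trans≤ σ₃≈σ₄ 3+n≤n₁ σ₄≈σ₅
                     in z⇒¬A-sound (<-≤-trans 1+n<3+n 3+n≤n₂) (<-≤-trans (<-≤-trans A<n (m≤n+m n 3)) 3+n≤n₂) λ i zᵢ →
                          ⊨-resp-≈ (NOT A) (≈-trans≤ σ≈σ₃ (m≤n+m n 3) σ₃≈σ₅) A<n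
                            (named⇒ (proj₁ (proj₂ (names σ₃≈σ₅))) zᵢ))
        where
        A<n : maxAtom A < n
        A<n = m⊔n<o⇒m<o _ _ AB<n
        B<n : maxAtom B < n
        B<n = m⊔n<o⇒n<o _ _ AB<n
        n<3+n : n < 3 + n
        n<3+n = s≤s (m≤n+m n 2)
        1+n<3+n : suc n < 3 + n
        1+n<3+n = s≤s (s≤s (m≤n+m n 1))
        group : Extensible σ₃ (3 + n) (grp x (posL n) (posL (2 + n)) (3 + n))
        group = grp-sound x (posL n) (posL (2 + n)) (<-≤-trans x<n (m≤n+m n 3)) n<3+n ≤-refl λ i xᵢ →
                  let (y≡¬B , _ , v≡¬A∩¬B) = names ≈-refl
                  in 𝕆-mono (named⇐ y≡¬B) (named⇐ v≡¬A∩¬B) (x⇒¬b𝕆¬a¬b i (T-resp-≈ (≈-sym σ≈σ₃) x<n xᵢ))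

      negated-binary-sound : Extensible σ n (negatedClauses x n cB cA)
      negated-binary-sound =
        ext-define ¬B λ σ≈σ₁ y≡¬B →
        ext-define ¬A λ σ₁≈σ₂ z≡¬A →
        ext-define (¬A ∩ ¬B) λ σ₂≈σ₃ v≡¬A∩¬B →
          negated-binary-sound-named (≈-trans≤ σ≈σ₁ (n≤1+n n) (≈-trans≤ σ₁≈σ₂ (n≤1+n _) σ₂≈σ₃)) λ σ₃≈τ →
            y≡¬B (≈-trans≤ σ₁≈σ₂ (n≤1+n _) (≈-trans≤ σ₂≈σ₃ (n≤1+n _) σ₃≈τ)) ,
            z≡¬A (≈-trans≤ σ₂≈σ₃ (n≤1+n _) σ₃≈τ) ,
            v≡¬A∩¬B σ₃≈τ

  mutual
    pos-sound : ∀ x A → Sound x A (pos x A)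
    pos-sound x (atom p)     x<n A<n x⇒a = ext-pure λ τ σ≈τ →
      rule5-intro {τ} (posL p ∷ []) λ i xᵢ → here (⇛-resp-≈ (atom p) σ≈τ x<n A<n x⇒a i xᵢ)
    pos-sound x TRUE         _   _   _   = ext-pure λ _ _ → rule5true-holds
    pos-sound x FALSE        x<n A<n x⇒a = ext-pure λ τ σ≈τ →
      rule5-intro {τ} [] λ i xᵢ → ⊥-elim (⇛-resp-≈ FALSE σ≈τ x<n A<n x⇒a i xᵢ)
    pos-sound x (NOT A)      = neg-sound x A
    pos-sound x (AND A B)    = conj-sound A B (pos-sound x A) (pos-sound x B)
    pos-sound x (OR A B)     x<n AB<n x⇒a∨b =
      rule5-sound (OR A B) x<n x⇒a∨b
        (disjunction-sound A B AB<n (dP-sound A (m⊔n<o⇒m<o _ _ AB<n)) λ n≤n₁ →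
           dP-sound B (<-≤-trans (m⊔n<o⇒n<o _ _ AB<n) n≤n₁))
    pos-sound x (IMP A B)    x<n AB<n x⇒a⇒b =
      rule5-sound (OR (NOT A) B) x<n (λ i xᵢ → implication (x⇒a⇒b i xᵢ))
        (disjunction-sound (NOT A) B AB<n (dN-sound A (m⊔n<o⇒m<o _ _ AB<n)) λ n≤n₁ →
           dP-sound B (<-≤-trans (m⊔n<o⇒n<o _ _ AB<n) n≤n₁))
    pos-sound x (NEXT A) {n = n} x<n A<n x⇒○a with dlits A in e
    ... | just (l , ls) = ext-pure λ τ σ≈τ →
            step-intro {τ} l ls (λ i xᵢ →
              Equivalence.to (dlits-sound A e) (⇛-resp-≈ (NEXT A) σ≈τ x<n A<n x⇒○a i xᵢ)) ∷ []
    ... | nothing       = next-sound A x<n A<n (pos-sound n A) x⇒○a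
    pos-sound x (SOMETIME A) {n = n} x<n A<n x⇒◇a with litOf A in e
    ... | just l  = ext-pure λ τ σ≈τ →
            (λ i _ xᵢ → let (k , i≤k , aₖ) = ⇛-resp-≈ (SOMETIME A) σ≈τ x<n A<n x⇒◇a i xᵢ
                        in k , i≤k , subst (τ , k ⊨_) (proj₁ (litOf-sound A e)) aₖ) ∷ []
    ... | nothing = sometime-sound A x<n A<n (pos-sound n A) x⇒◇a
    pos-sound x (ALWAYS A) {σ} {n} x<n A<n x⇒□a with litOf A in e
    ... | just l  = boxLit-sound x l x<n (≤-<-trans (proj₂ (litOf-sound A e)) A<n) λ i xᵢ j i≤j →
                      subst (σ , j ⊨_) (proj₁ (litOf-sound A e)) (x⇒□a i xᵢ j i≤j)
    ... | nothing = always-sound A x<n A<n (pos-sound n A) x⇒□a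
    pos-sound x (UNTIL A B)  {n = n} x<n AB<n x⇒aUb =
      binary-sound until-mono untilLit untilLit-sound A B x<n AB<n x⇒aUb
        (litArg-sound A (pos-sound n A) (m⊔n<o⇒m<o _ _ AB<n)) λ n≤n₁ →
          litArg-sound B (pos-sound _ B) (<-≤-trans (m⊔n<o⇒n<o _ _ AB<n) n≤n₁)
    pos-sound x (UNLESS A B) {n = n} x<n AB<n x⇒aWb =
      binary-sound unless-mono unlessLit unlessLit-sound A B x<n AB<n x⇒aWb
        (litArg-sound A (pos-sound n A) (m⊔n<o⇒m<o _ _ AB<n)) λ n≤n₁ →
          litArg-sound B (pos-sound _ B) (<-≤-trans (m⊔n<o⇒n<o _ _ AB<n) n≤n₁)

    neg-sound : ∀ x A → Sound x (NOT A) (neg x A)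
    neg-sound x (atom p)     x<n A<n x⇒¬a = ext-pure λ τ σ≈τ →
      rule5-intro {τ} (negL p ∷ []) λ i xᵢ → here (⇛-resp-≈ (NOT (atom p)) σ≈τ x<n A<n x⇒¬a i xᵢ)
    neg-sound x TRUE         x<n A<n x⇒¬a = ext-pure λ τ σ≈τ →
      rule5-intro {τ} [] λ i xᵢ → ⊥-elim (⇛-resp-≈ (NOT TRUE) σ≈τ x<n A<n x⇒¬a i xᵢ tt)
    neg-sound x FALSE        _   _   _    = ext-pure λ _ _ → rule5true-holds
    neg-sound x (NOT A)      x<n A<n x⇒¬¬a = pos-sound x A x<n A<n λ i xᵢ → dne (x⇒¬¬a i xᵢ)
    neg-sound x (OR A B)     x<n AB<n x⇒¬a∨b =
      conj-sound (NOT A) (NOT B) (neg-sound x A) (neg-sound x B) x<n AB<n λ i xᵢ →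
        (λ a → x⇒¬a∨b i xᵢ (inj₁ a)) , (λ b → x⇒¬a∨b i xᵢ (inj₂ b))
    neg-sound x (IMP A B)    x<n AB<n x⇒¬a⇒b =
      conj-sound A (NOT B) (pos-sound x A) (neg-sound x B) x<n AB<n λ i xᵢ → ¬implication (x⇒¬a⇒b i xᵢ)
    neg-sound x (AND A B)    x<n AB<n x⇒¬a∧b =
      rule5-sound (OR (NOT A) (NOT B)) x<n (λ i xᵢ → ¬conjunction (x⇒¬a∧b i xᵢ))
        (disjunction-sound (NOT A) (NOT B) AB<n (dN-sound A (m⊔n<o⇒m<o _ _ AB<n)) λ n≤n₁ →
           dN-sound B (<-≤-trans (m⊔n<o⇒n<o _ _ AB<n) n≤n₁))
    neg-sound x (NEXT A)     {n = n} x<n A<n x⇒¬○a = next-sound (NOT A) x<n A<n (neg-sound n A) x⇒¬○a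
    neg-sound x (ALWAYS A)   {n = n} x<n A<n x⇒¬□a =
      sometime-sound (NOT A) x<n A<n (neg-sound n A) λ i xᵢ → ¬always⇒eventually (x⇒¬□a i xᵢ)
    neg-sound x (SOMETIME A) {n = n} x<n A<n x⇒¬◇a =
      always-sound (NOT A) x<n A<n (neg-sound n A) λ i xᵢ j i≤j aⱼ → x⇒¬◇a i xᵢ (j , i≤j , aⱼ)
    neg-sound x (UNTIL A B)  {n = n} x<n AB<n x⇒¬aUb =
      negated-binary-sound unless-mono unlessLit unlessLit-sound A B x<n AB<n
        (λ i xᵢ → ¬until⇒unless (x⇒¬aUb i xᵢ)) (neg-sound n B) (neg-sound (suc n) A)
    neg-sound x (UNLESS A B) {n = n} x<n AB<n x⇒¬aWb =
      negated-binary-sound until-mono untilLit untilLit-sound A B x<n AB<n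
        (λ i xᵢ → ¬unless⇒until (x⇒¬aWb i xᵢ)) (neg-sound n B) (neg-sound (suc n) A)

    dP-sound : ∀ A → DisjSound A (dP A)
    dP-sound A {σ} {n} A<n with disjunctView A
    ... | disjunction B C = disjunction-sound B C A<n (dP-sound B (m⊔n<o⇒m<o _ _ A<n)) λ n≤n₁ →
                              dP-sound C (<-≤-trans (m⊔n<o⇒n<o _ _ A<n) n≤n₁)
    ... | disjunct dP≡    = subst (DisjRealises σ n A) (sym (dP≡ n))
                              (asDisjunct-sound A (litArg A n) (litArg-sound A (pos-sound n A) A<n))

    dN-sound : ∀ A → DisjSound (NOT A) (dN A)
    dN-sound A {σ} {n} A<n =
      subst (DisjRealises σ n (NOT A)) (sym (dN≡litArg-NOT A n))
        (asDisjunct-sound (NOT A) (litArg (NOT A) n) (litArg-sound (NOT A) (neg-sound n A) A<n))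

⊨-bigAnd : ∀ {σ} B cs → σ , 0 ⊨ bigAnd B (map ALWAYS cs) ⇔ (σ , 0 ⊨ B × σ ⊨* cs)
⊨-bigAnd B []       = mk⇔ (λ b → b , []) proj₁
⊨-bigAnd B (C ∷ cs) =
  mk⇔ (λ (b , rest) → let (c , cs′) = Equivalence.to (⊨-bigAnd (ALWAYS C) cs) rest in b , c ∷ cs′)
      λ { (b , c ∷ cs′) → b , Equivalence.from (⊨-bigAnd (ALWAYS C) cs) (c , cs′) }

theorem3 : ExcludedMiddle 0ℓ → (A : Fml) → Satisfiable (emb A) ⇔ Satisfiable (τ₀ A)
theorem3 lem A = mk⇔ sound complete
  where
  open Classical lem
  y : Atom
  y = suc (maxAtom A)
  y-marks-start : ∀ {σ} → σ , 0 ⊨ emb A →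
                  Extension σ y (proj₂ (pos y A (suc y))) (λ τ → τ , 0 ⊨ ALWAYS (IMP START (atom y)) × τ ⊨* τ₁ y A)
  y-marks-start {σ} a₀ =
    ext-define (_≡ 0) λ σ≈σ′ y≡start →
      ext-map (λ τ σ′≈τ _ cs → (λ j _ j≡0 → named⇐ (y≡start σ′≈τ) j≡0) , cs)
        (pos-sound y A (n<1+n y) (m<n⇒m<1+n (n<1+n _)) λ i yᵢ →
          subst (_ ,_⊨ emb A) (sym (named⇒ (y≡start ≈-refl) yᵢ)) (⊨-resp-≈ A σ≈σ′ (n<1+n _) a₀))
  sound : Satisfiable (emb A) → Satisfiable (τ₀ A)
  sound (σ , a₀) =
    let (τ , start⇒y , cs) = ext-model (y-marks-start a₀)
    in τ , Equivalence.from (⊨-bigAnd _ (τ₁ y A)) (start⇒y , cs)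
  complete : Satisfiable (τ₀ A) → Satisfiable (emb A)
  complete (σ , τ₀-holds) =
    let (start⇒y , cs) = Equivalence.to (⊨-bigAnd _ (τ₁ y A)) τ₀-holds
    in σ , pos-complete y A (suc y) cs 0 (start⇒y 0 z≤n refl)
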